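{- Let $r \geq 1$ be an integer and let $b > 1$ be an integer with $\gcd(2,b) = 1$ such that $2^r b^2$ is almost perfect. Then $$r < \log_2 b - 1,$$ i.e. $2^{r+1} < b$.
   Context: $\sigma(x)$ denotes the sum of the positive divisors of $x$. A positive integer $y$ is almost perfect if $\sigma(y) = 2y - 1$. -}

module Defs where

open import Data.Nat using (ℕ; zero; suc; _+_; _*_; _∸_)
open import Data.Nat.Divisibility using (_∣?_)
open import Data.List using (List; filter; upTo; map)
open import Data.Nat.ListAction using (sum)
open import Relation.Binary.PropositionalEquality using (_≡_)

divisors : ℕ → List ℕ
divisors n = filter (_∣? n) (map suc (upTo n))

σ : ℕ → ℕ
σ n = sum (divisors n)

AlmostPerfect : ℕ → Set
AlmostPerfect y = σ y ≡ 2 * y ∸ 1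

module Submission where

-- Idea: the 3(r+1) numbers 2^i·c with 0 ≤ i ≤ r and c ∈ {1, b, b²} are
-- pairwise distinct divisors of y (distinct because 1, b, b² are distinct
-- and odd), so their sum (2^(r+1) − 1)(1 + b + b²) is at most σ(y) = 2y − 1.
-- Writing S = 1 + b + b² = 1 + b(1 + b) and P = 2^(r+1), this reads
-- P·S < P·b² + S, i.e. P(1 + b) ≤ b(1 + b), i.e. P ≤ b; as P is even and b
-- is odd, P < b.

open import Defs
open import Data.Nat using (ℕ; _+_; _*_; _^_; _≤_; _<_; _∸_; zero; suc; z≤n; z<s; >-nonZero)
open import Data.Nat.GCD using (gcd; gcd-greatest)
open import Data.Nat.Properties
open import Data.Nat.Divisibility
open import Data.Nat.Primality using (euclidsLemma; prime[2])
open import Data.Nat.ListAction using (sum)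
open import Data.Nat.ListAction.Properties using (sum-++)
open import Data.List using (List; []; _∷_; _++_; map)
import Data.List.Relation.Unary.All as All
open All using (All; []; _∷_; lookup)
import Data.List.Relation.Unary.All.Properties as AllProp
open import Data.List.Relation.Unary.AllPairs using ([]; _∷_)
open import Data.List.Relation.Unary.Unique.Propositional using (Unique)
import Data.List.Relation.Unary.Unique.Propositional.Properties as Unique
open import Data.List.Relation.Binary.Disjoint.Propositional using (Disjoint)
open import Data.List.Membership.Propositional using (_∈_)
open import Data.List.Membership.Propositional.Properties
  using (∈-filter⁺; ∈-upTo⁺; ∈-map⁺; ∈-map⁻)
open import Data.List.Relation.Unary.Any using (here; there)
open import Data.Product using (Σ; _,_; _×_)
open import Data.Sum using ([_,_]′)
open import Function using (_∘′_)
open import Data.Empty using (⊥-elim)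
open import Relation.Nullary using (¬_)
open import Relation.Binary.PropositionalEquality
open import Data.Nat.Solver using (module +-*-Solver)
open +-*-Solver using (solve; _:+_; _:*_; _:=_; con)

removeOne : ∀ {x : ℕ} {ys} → x ∈ ys →
  Σ (List ℕ) λ zs → (sum ys ≡ x + sum zs) × (∀ {y} → y ∈ ys → x ≢ y → y ∈ zs)
removeOne {ys = _ ∷ ys} (here refl) = ys , refl , keep
  where
  keep : ∀ {y} → y ∈ _ ∷ ys → _ ≢ y → y ∈ ys
  keep (here refl) x≢x = ⊥-elim (x≢x refl)
  keep (there y∈ys) _  = y∈ys
removeOne {x} {y₀ ∷ ys} (there x∈ys) with removeOne x∈ys
... | zs , sum≡ , survives = y₀ ∷ zs , sum≡′ , keep
  where
  sum≡′ : y₀ + sum ys ≡ x + (y₀ + sum zs)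
  sum≡′ = begin
    y₀ + sum ys        ≡⟨ cong (y₀ +_) sum≡ ⟩
    y₀ + (x + sum zs)  ≡⟨ +-comm y₀ _ ⟩
    (x + sum zs) + y₀  ≡⟨ +-assoc x _ y₀ ⟩
    x + (sum zs + y₀)  ≡⟨ cong (x +_) (+-comm (sum zs) y₀) ⟩
    x + (y₀ + sum zs)  ∎
    where open ≡-Reasoning
  keep : ∀ {y} → y ∈ y₀ ∷ ys → x ≢ y → y ∈ y₀ ∷ zs
  keep (here refl)  _   = here refl
  keep (there y∈ys) x≢y = there (survives y∈ys x≢y)

sum-mono-⊆ : ∀ xs ys → Unique xs → All (_∈ ys) xs → sum xs ≤ sum ys
sum-mono-⊆ []       ys _            _             = z≤n
sum-mono-⊆ (x ∷ xs) ys (x∉xs ∷ uxs) (x∈ys ∷ xs⊆ys) with removeOne x∈ys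
... | zs , sum≡ , survives =
  subst (x + sum xs ≤_) (sym sum≡) (+-monoʳ-≤ x (sum-mono-⊆ xs zs uxs xs⊆zs))
  where
  xs⊆zs : All (_∈ zs) xs
  xs⊆zs = All.zipWith (λ (x≢y , y∈ys) → survives y∈ys x≢y) (x∉xs , xs⊆ys)

∣⇒∈divisors : ∀ {d n} → 0 < n → d ∣ n → d ∈ divisors n
∣⇒∈divisors {zero}  {suc m} _ 0∣n with () ← 0∣⇒≡0 0∣n
∣⇒∈divisors {suc d} {suc m} _ d∣n =
  ∈-filter⁺ (_∣? suc m) (∈-map⁺ suc (∈-upTo⁺ (∣⇒≤ d∣n))) d∣n

sum-divisors≤σ : ∀ {n} ds → 0 < n → Unique ds → All (_∣ n) ds → sum ds ≤ σ n
sum-divisors≤σ {n} ds 0<n uds ds∣n =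
  sum-mono-⊆ ds (divisors n) uds (All.map (∣⇒∈divisors 0<n) ds∣n)

almostPerfect-bound : ∀ {y} ds → AlmostPerfect y → 0 < y →
  Unique ds → All (_∣ y) ds → sum ds < 2 * y
almostPerfect-bound {y} ds ap 0<y uds ds∣y = begin-strict
  sum ds             ≤⟨ subst (sum ds ≤_) ap (sum-divisors≤σ ds 0<y uds ds∣y) ⟩
  2 * y ∸ 1          <⟨ ∸-monoʳ-< z<s (≤-trans 0<y (m≤n*m y 2)) ⟩
  2 * y              ∎
  where open ≤-Reasoning

-- Odd numbers, stated via divisibility (the only form the argument uses).
Odd : ℕ → Set
Odd n = ¬ 2 ∣ n

dyadicMultiples : List ℕ → ℕ → List ℕ
dyadicMultiples cs zero    = cs
dyadicMultiples cs (suc r) = cs ++ map (2 *_) (dyadicMultiples cs r)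

sum-double : ∀ xs → sum (map (2 *_) xs) ≡ 2 * sum xs
sum-double []       = refl
sum-double (x ∷ xs) =
  trans (cong (2 * x +_) (sum-double xs)) (sym (*-distribˡ-+ 2 x (sum xs)))

sum-dyadicMultiples : ∀ cs r →
  sum (dyadicMultiples cs r) + sum cs ≡ 2 ^ suc r * sum cs
sum-dyadicMultiples cs zero    = cong (sum cs +_) (sym (+-identityʳ (sum cs)))
sum-dyadicMultiples cs (suc r) = begin
  sum (cs ++ map (2 *_) M) + S  ≡⟨ cong (_+ S) (sum-++ cs (map (2 *_) M)) ⟩
  S + sum (map (2 *_) M) + S    ≡⟨ cong (λ z → S + z + S) (sum-double M) ⟩
  S + 2 * sum M + S             ≡⟨ solve 2 (λ s m → s :+ con 2 :* m :+ s
                                              := con 2 :* (m :+ s)) refl S (sum M) ⟩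
  2 * (sum M + S)               ≡⟨ cong (2 *_) (sum-dyadicMultiples cs r) ⟩
  2 * (2 ^ suc r * S)           ≡⟨ *-assoc 2 (2 ^ suc r) S ⟨
  2 ^ suc (suc r) * S           ∎
  where
  open ≡-Reasoning
  S : ℕ
  S = sum cs
  M : List ℕ
  M = dyadicMultiples cs r

dyadicMultiples-∣ : ∀ {m} cs r → All (_∣ m) cs →
  All (_∣ 2 ^ r * m) (dyadicMultiples cs r)
dyadicMultiples-∣ {m} cs zero    cs∣m = All.map (λ c∣m → ∣-trans c∣m ∣m) cs∣m
  where ∣m = ∣-reflexive (sym (+-identityʳ m))
dyadicMultiples-∣ {m} cs (suc r) cs∣m = AllProp.++⁺
  (All.map (λ c∣m → ∣-trans c∣m (n∣m*n (2 ^ suc r))) cs∣m)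
  (AllProp.map⁺ (All.map double (dyadicMultiples-∣ cs r cs∣m)))
  where
  double : ∀ {x} → x ∣ 2 ^ r * m → 2 * x ∣ 2 ^ suc r * m
  double {x} x∣ = subst (2 * x ∣_) (sym (*-assoc 2 (2 ^ r) m)) (*-monoʳ-∣ 2 x∣)

odd≢double : ∀ {x} y → Odd x → x ≢ 2 * y
odd≢double y odd-x x≡2y = odd-x (divides y (trans x≡2y (*-comm 2 y)))

odd-disjoint-doubles : ∀ cs xs → All Odd cs →
  Disjoint cs (map (2 *_) xs)
odd-disjoint-doubles cs xs odd-cs (c∈cs , c∈2xs) with ∈-map⁻ (2 *_) c∈2xs
... | y , _ , c≡2y = odd≢double y (lookup odd-cs c∈cs) c≡2y

dyadicMultiples-unique : ∀ cs r → Unique cs → All Odd cs →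
  Unique (dyadicMultiples cs r)
dyadicMultiples-unique cs zero    ucs _      = ucs
dyadicMultiples-unique cs (suc r) ucs odd-cs = Unique.++⁺ ucs
  (Unique.map⁺ (*-cancelˡ-≡ _ _ 2) (dyadicMultiples-unique cs r ucs odd-cs))
  (odd-disjoint-doubles cs _ odd-cs)

module OddBase {b : ℕ} (1<b : 1 < b) (odd-b : Odd b) where

  bases : List ℕ
  bases = 1 ∷ b ∷ b * b ∷ []

  b<b² : b < b * b
  b<b² = m<m*n b b {{>-nonZero (<-trans z<s 1<b)}} 1<b

  bases-unique : Unique bases
  bases-unique = (<⇒≢ 1<b ∷ <⇒≢ (<-trans 1<b b<b²) ∷ [])
               ∷ (<⇒≢ b<b² ∷ [])
               ∷ []
               ∷ []

  bases-odd : All Odd bases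
  bases-odd = (λ 2∣1 → 1+n≰n (∣⇒≤ 2∣1))
            ∷ odd-b
            ∷ [ odd-b , odd-b ]′ ∘′ euclidsLemma b b prime[2]
            ∷ []

  -- 1 + b + b², in the form used by `geometric-bound`.
  sum-bases : sum bases ≡ 1 + b * (1 + b)
  sum-bases = solve 1 (λ b → con 1 :+ (b :+ (b :* b :+ con 0))
                             := con 1 :+ b :* (con 1 :+ b)) refl b

  bases-∣ : All (_∣ b * b) bases
  bases-∣ = 1∣ _ ∷ m∣m*n b ∷ ∣-refl ∷ []

geometric-bound : ∀ P b s →
  s + (1 + b * (1 + b)) ≡ P * (1 + b * (1 + b)) → s < P * (b * b) → P ≤ b
geometric-bound P b s sum≡ s<Pb² = *-cancelʳ-≤ P b (1 + b) (m<1+n⇒m≤n P[1+b]<1+b[1+b])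
  where
  S : ℕ
  S = 1 + b * (1 + b)
  P[1+b]<1+b[1+b] : P * (1 + b) < S
  P[1+b]<1+b[1+b] = +-cancelʳ-< (P * (b * b)) (P * (1 + b)) S (begin-strict
    P * (1 + b) + P * (b * b)  ≡⟨ solve 2 (λ p b → p :* (con 1 :+ b) :+ p :* (b :* b)
                                    := p :* (con 1 :+ b :* (con 1 :+ b))) refl P b ⟩
    P * S                      ≡⟨ sum≡ ⟨
    s + S                      <⟨ +-monoˡ-< S s<Pb² ⟩
    P * (b * b) + S            ≡⟨ +-comm (P * (b * b)) S ⟩
    S + P * (b * b)            ∎)
    where open ≤-Reasoning

theorem3 : (r b : ℕ) → 1 ≤ r → 1 < b → gcd 2 b ≡ 1 →
    AlmostPerfect (2 ^ r * (b * b)) → 2 ^ (r + 1) < b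
theorem3 r b _ 1<b gcd≡1 ap =
  subst (_< b) (cong (2 ^_) (+-comm 1 r)) (≤∧≢⇒< P≤b P≢b)
  where
  odd-b : Odd b
  odd-b 2∣b = 1+n≰n (∣⇒≤ (subst (2 ∣_) gcd≡1 (gcd-greatest ∣-refl 2∣b)))
  open OddBase 1<b odd-b
  P : ℕ
  P = 2 ^ suc r
  ds : List ℕ
  ds = dyadicMultiples bases r
  0<y : 0 < 2 ^ r * (b * b)
  0<y = *-mono-≤ (m^n>0 2 r) (*-mono-≤ (<-trans z<s 1<b) (<-trans z<s 1<b))
  sum-ds<Pb² : sum ds < P * (b * b)
  sum-ds<Pb² = subst (sum ds <_) (sym (*-assoc 2 (2 ^ r) (b * b)))
    (almostPerfect-bound ds ap 0<y (dyadicMultiples-unique bases r bases-unique bases-odd)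
                                   (dyadicMultiples-∣ bases r bases-∣))
  sum-ds≡ : sum ds + (1 + b * (1 + b)) ≡ P * (1 + b * (1 + b))
  sum-ds≡ = subst (λ S → sum ds + S ≡ P * S) sum-bases (sum-dyadicMultiples bases r)
  P≤b : P ≤ b
  P≤b = geometric-bound P b (sum ds) sum-ds≡ sum-ds<Pb²
  P≢b : P ≢ b
  P≢b P≡b = odd≢double (2 ^ r) odd-b (sym P≡b)
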